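{- Let $\mathbf A$ be a Łukasiewicz near semiring and $I$ an ideal of $\mathbf A$. Then the relation $\theta(I)$ defined for $a,b\in A$ by $a\,\theta(I)\,b$ iff $a^{\alpha}b\in I$ and $b^{\alpha}a\in I$ is a congruence on $\mathbf A$, and $[0]_{\theta(I)}=I$.
   Context: An $\iota$-near semiring is an algebra $\langle A,+,\cdot,{}^{\alpha},0,1\rangle$ of type $\langle 2,2,1,0,0\rangle$ such that $\langle A,+\rangle$ is a join semilattice with least element $0$ and greatest element $1$ (order $x\le y$ iff $x+y=y$), $x\cdot1=x=1\cdot x$, $(x+y)\cdot z=xz+yz$, $x0=0x=0$, $(x^{\alpha})^{\alpha}=x$, and $x\le y$ implies $y^{\alpha}\le x^{\alpha}$. A Łukasiewicz near semiring is an $\iota$-near semiring satisfying $(x y^{\alpha})^{\alpha} y^{\alpha}=(y x^{\alpha})^{\alpha} x^{\alpha}$. Juxtaposition $xy$ denotes $x\cdot y$. An ideal of $\mathbf A$ is a set $I\subseteq A$ with $0\in I$ such that (I1) if $ab^{\alpha}\in I$ and $b\in I$ then $a\in I$; (I2) if $a^{\alpha}b\in I$ and $b^{\alpha}a\in I$ then $(ac)^{\alpha}(bc)\in I$ and $(ca)^{\alpha}(cb)\in I$ for every $c\in A$. -}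

module Defs where

open import Level using (Level; suc; _⊔_)
open import Relation.Binary.PropositionalEquality using (_≡_)
open import Data.Product using (_×_)
open import Function.Bundles using (_⇔_)

record IotaNearSemiring (a : Level) : Set (suc a) where
  infixl 6 _+_
  infixl 7 _·_
  field
    Carrier : Set a
    _+_     : Carrier → Carrier → Carrier
    _·_     : Carrier → Carrier → Carrier
    α       : Carrier → Carrier
    𝟎       : Carrier
    𝟏       : Carrier

  _≤_ : Carrier → Carrier → Set a
  x ≤ y = x + y ≡ y

  field
    +-assoc  : ∀ x y z → (x + y) + z ≡ x + (y + z)
    +-comm   : ∀ x y → x + y ≡ y + x
    +-idem   : ∀ x → x + x ≡ x
    +-zero   : ∀ x → x + 𝟎 ≡ x
    +-one    : ∀ x → x + 𝟏 ≡ 𝟏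
    ·-identityʳ : ∀ x → x · 𝟏 ≡ x
    ·-identityˡ : ∀ x → 𝟏 · x ≡ x
    ·-distribʳ  : ∀ x y z → (x + y) · z ≡ x · z + y · z
    ·-zeroʳ     : ∀ x → x · 𝟎 ≡ 𝟎
    ·-zeroˡ     : ∀ x → 𝟎 · x ≡ 𝟎
    α-invol     : ∀ x → α (α x) ≡ x
    α-antitone  : ∀ x y → x ≤ y → α y ≤ α x

record LukasiewiczNearSemiring (a : Level) : Set (suc a) where
  field
    iota : IotaNearSemiring a
  open IotaNearSemiring iota public
  field
    luk : ∀ x y → α (x · α y) · α y ≡ α (y · α x) · α x

module _ {a : Level} (A : IotaNearSemiring a) where
  open IotaNearSemiring A

  record IsIdeal {ℓ : Level} (I : Carrier → Set ℓ) : Set (a ⊔ ℓ) where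
    field
      zero∈ : I 𝟎
      I1    : ∀ x y → I (x · α y) → I y → I x
      I2    : ∀ x y → I (α x · y) → I (α y · x) →
              ∀ c → I (α (x · c) · (y · c)) × I (α (c · x) · (c · y))

  θ : {ℓ : Level} → (Carrier → Set ℓ) → Carrier → Carrier → Set ℓ
  θ I x y = I (α x · y) × I (α y · x)

  record IsCongruence {ℓ : Level} (R : Carrier → Carrier → Set ℓ) : Set (a ⊔ ℓ) where
    field
      refl  : ∀ x → R x x
      sym   : ∀ x y → R x y → R y x
      trans : ∀ x y z → R x y → R y z → R x z
      +-cong : ∀ x y u v → R x y → R u v → R (x + u) (y + v)
      ·-cong : ∀ x y u v → R x y → R u v → R (x · u) (y · v)
      α-cong : ∀ x y → R x y → R (α x) (α y)

  ClassOfZeroIs : {ℓ ℓ' : Level} → (Carrier → Carrier → Set ℓ) → (Carrier → Set ℓ') → Set (a ⊔ ℓ ⊔ ℓ')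
  ClassOfZeroIs R I = ∀ x → R x 𝟎 ⇔ I x

module Submission where

-- Reflexivity and symmetry of θ are immediate, transitivity follows by
-- multiplying on the left by α x and using closure of I under θ, and
-- compatibility with α, · and + follows in turn (for + through the
-- definition of the join by · and α).  Finally α 𝟎 = 𝟏 gives [0]_θ = I.

open import Defs
open import Level using (Level)
open import Data.Product using (_×_; _,_; proj₁; proj₂)
open import Function.Bundles using (mk⇔)
open import Relation.Binary.PropositionalEquality as Eq
  using (_≡_; cong; cong₂; subst; subst₂)
open Eq.≡-Reasoning

module IotaProperties {a : Level} (A : IotaNearSemiring a) where
  open IotaNearSemiring A

  ≤𝟎⇒≡𝟎 : ∀ x → x ≤ 𝟎 → x ≡ 𝟎
  ≤𝟎⇒≡𝟎 x p = Eq.trans (Eq.sym (+-zero x)) p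

  ≤-antisym : ∀ x y → x ≤ y → y ≤ x → x ≡ y
  ≤-antisym x y p q = Eq.trans (Eq.sym q) (Eq.trans (+-comm y x) p)

  +-lub : ∀ x u w → x ≤ w → u ≤ w → (x + u) ≤ w
  +-lub x u w p q = Eq.trans (+-assoc x u w) (Eq.trans (cong (x +_) q) p)

  ≤-+ʳ : ∀ x u → u ≤ (x + u)
  ≤-+ʳ x u = begin
    u + (x + u) ≡⟨ cong (u +_) (+-comm x u) ⟩
    u + (u + x) ≡⟨ Eq.sym (+-assoc u u x) ⟩
    (u + u) + x ≡⟨ cong (_+ x) (+-idem u) ⟩
    u + x       ≡⟨ +-comm u x ⟩
    x + u       ∎

  ≤-+ˡ : ∀ x u → x ≤ (x + u)
  ≤-+ˡ x u = subst (x ≤_) (+-comm u x) (≤-+ʳ u x)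

  ·-monoˡ-≤ : ∀ x y z → x ≤ y → (x · z) ≤ (y · z)
  ·-monoˡ-≤ x y z p = Eq.trans (Eq.sym (·-distribʳ x y z)) (cong (_· z) p)

  x·y≤y : ∀ x y → (x · y) ≤ y
  x·y≤y x y = subst ((x · y) ≤_) (·-identityˡ y) (·-monoˡ-≤ x 𝟏 y (+-one x))

  ≤-α-swap : ∀ x y → x ≤ α y → y ≤ α x
  ≤-α-swap x y p = subst (_≤ α x) (α-invol y) (α-antitone x (α y) p)

  α𝟏≡𝟎 : α 𝟏 ≡ 𝟎
  α𝟏≡𝟎 = ≤𝟎⇒≡𝟎 (α 𝟏)
    (subst (α 𝟏 ≤_) (α-invol 𝟎) (α-antitone (α 𝟎) 𝟏 (+-one (α 𝟎))))

  α𝟎≡𝟏 : α 𝟎 ≡ 𝟏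
  α𝟎≡𝟏 = Eq.trans (cong α (Eq.sym α𝟏≡𝟎)) (α-invol 𝟏)

  α𝟎·x≡x : ∀ x → α 𝟎 · x ≡ x
  α𝟎·x≡x x = Eq.trans (cong (_· x) α𝟎≡𝟏) (·-identityˡ x)

module LukasiewiczProperties {a : Level} (A : LukasiewiczNearSemiring a) where
  open LukasiewiczNearSemiring A
  open IotaProperties iota

  -- Complementation: x · α x = 𝟎 (the Łukasiewicz law with y = 𝟏).
  x·αx≡𝟎 : ∀ x → x · α x ≡ 𝟎
  x·αx≡𝟎 x = begin
    x · α x             ≡⟨ cong (_· α x) (Eq.sym (α-invol x)) ⟩
    α (α x) · α x       ≡⟨ cong (λ t → α t · α x) (Eq.sym (·-identityˡ (α x))) ⟩
    α (𝟏 · α x) · α x   ≡⟨ Eq.sym (luk x 𝟏) ⟩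
    α (x · α 𝟏) · α 𝟏   ≡⟨ cong (α (x · α 𝟏) ·_) α𝟏≡𝟎 ⟩
    α (x · α 𝟏) · 𝟎     ≡⟨ ·-zeroʳ _ ⟩
    𝟎                   ∎

  αx·x≡𝟎 : ∀ x → α x · x ≡ 𝟎
  αx·x≡𝟎 x = Eq.trans (cong (α x ·_) (Eq.sym (α-invol x))) (x·αx≡𝟎 (α x))

  ≤⇒x·αy≡𝟎 : ∀ x y → x ≤ y → x · α y ≡ 𝟎
  ≤⇒x·αy≡𝟎 x y p = ≤𝟎⇒≡𝟎 _
    (Eq.trans (cong (x · α y +_) (Eq.sym (x·αx≡𝟎 y)))
              (Eq.trans (·-monoˡ-≤ x y (α y) p) (x·αx≡𝟎 y)))

  ≤⇒divides : ∀ q p → q ≤ p → α (α q · p) · p ≡ q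
  ≤⇒divides q p le = begin
    α (α q · p) · p
      ≡⟨ cong₂ (λ s t → α (α q · s) · t) (Eq.sym (α-invol p)) (Eq.sym (α-invol p)) ⟩
    α (α q · α (α p)) · α (α p)
      ≡⟨ luk (α q) (α p) ⟩
    α (α p · α (α q)) · α (α q)
      ≡⟨ cong (λ t → α t · α (α q)) (≤⇒x·αy≡𝟎 (α p) (α q) (α-antitone q p le)) ⟩
    α 𝟎 · α (α q)
      ≡⟨ α𝟎·x≡x (α (α q)) ⟩
    α (α q)
      ≡⟨ α-invol q ⟩
    q ∎

  α-+≡meet : ∀ x u → α (x + u) ≡ α (x · α u) · α u
  α-+≡meet x u = ≤-antisym z m z≤m m≤z
    where
    m z : Carrier
    m = α (x · α u) · α u
    z = α (x + u)

    -- z = α (α z · α u) · α u, and α z · α u ≥ x · α u since α z ≥ x.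
    z≤m : z ≤ m
    z≤m = subst (_≤ m) (≤⇒divides z (α u) (α-antitone u (x + u) (≤-+ʳ x u)))
      (·-monoˡ-≤ _ _ (α u)
        (α-antitone _ _ (·-monoˡ-≤ x (α z) (α u)
          (≤-α-swap z x (α-antitone x (x + u) (≤-+ˡ x u))))))

    -- m ≤ α u and, by the Łukasiewicz law, m ≤ α x.
    m≤αx : m ≤ α x
    m≤αx = subst (_≤ α x) (Eq.sym (luk x u)) (x·y≤y _ _)

    m≤z : m ≤ z
    m≤z = ≤-α-swap (x + u) m
      (+-lub x u (α m) (≤-α-swap m x m≤αx) (≤-α-swap m u (x·y≤y _ _)))

  +-via-·α : ∀ x u → x + u ≡ α (α (x · α u) · α u)
  +-via-·α x u = Eq.trans (Eq.sym (α-invol (x + u))) (cong α (α-+≡meet x u))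

module IdealCongruence {a ℓ : Level} (A : LukasiewiczNearSemiring a)
  (I : LukasiewiczNearSemiring.Carrier A → Set ℓ)
  (isIdeal : IsIdeal (LukasiewiczNearSemiring.iota A) I) where
  open LukasiewiczNearSemiring A
  open IotaProperties iota
  open LukasiewiczProperties A
  open IsIdeal isIdeal

  _≈_ : Carrier → Carrier → Set ℓ
  _≈_ = θ iota I

  ≈-refl : ∀ x → x ≈ x
  ≈-refl x = I𝟎 , I𝟎
    where
    I𝟎 : I (α x · x)
    I𝟎 = subst I (Eq.sym (αx·x≡𝟎 x)) zero∈

  ≈-sym : ∀ x y → x ≈ y → y ≈ x
  ≈-sym x y (p , q) = q , p

  ≈-·ʳ : ∀ x y → x ≈ y → ∀ c → (x · c) ≈ (y · c)
  ≈-·ʳ x y (p , q) c = proj₁ (I2 x y p q c) , proj₁ (I2 y x q p c)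

  ≈-·ˡ : ∀ x y → x ≈ y → ∀ c → (c · x) ≈ (c · y)
  ≈-·ˡ x y (p , q) c = proj₂ (I2 x y p q c) , proj₂ (I2 y x q p c)

  -- x θ y gives y · α x ∈ I: multiply on the right by α x and use x · α x = 𝟎.
  ≈⇒y·αx∈I : ∀ x y → x ≈ y → I (y · α x)
  ≈⇒y·αx∈I x y x≈y = subst I simplify (proj₁ (≈-·ʳ x y x≈y (α x)))
    where
    simplify : α (x · α x) · (y · α x) ≡ y · α x
    simplify = Eq.trans (cong (λ t → α t · (y · α x)) (x·αx≡𝟎 x)) (α𝟎·x≡x _)

  ∈I-resp-≈ : ∀ x y → x ≈ y → I x → I y
  ∈I-resp-≈ x y x≈y x∈I = I1 y x (≈⇒y·αx∈I x y x≈y) x∈I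

  -- From y θ z: α x · y θ α x · z, so α x · y ∈ I transfers to α x · z ∈ I.
  ≈-trans : ∀ x y z → x ≈ y → y ≈ z → x ≈ z
  ≈-trans x y z (p , q) (r , s) =
    ∈I-resp-≈ (α x · y) (α x · z) (≈-·ˡ y z (r , s) (α x)) p ,
    ∈I-resp-≈ (α z · y) (α z · x) (≈-·ˡ y x (q , p) (α z)) s

  ≈-α : ∀ x y → x ≈ y → α x ≈ α y
  ≈-α x y x≈y =
    subst (λ s → I (s · α y)) (Eq.sym (α-invol x)) (≈⇒y·αx∈I y x (≈-sym x y x≈y)) ,
    subst (λ s → I (s · α x)) (Eq.sym (α-invol y)) (≈⇒y·αx∈I x y x≈y)

  ≈-· : ∀ x y u v → x ≈ y → u ≈ v → (x · u) ≈ (y · v)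
  ≈-· x y u v x≈y u≈v = ≈-trans _ _ _ (≈-·ʳ x y x≈y u) (≈-·ˡ u v u≈v y)

  -- Compatibility with + reduces to · and α through x + u = α (α (x · α u) · α u).
  ≈-+ : ∀ x y u v → x ≈ y → u ≈ v → (x + u) ≈ (y + v)
  ≈-+ x y u v x≈y u≈v = subst₂ _≈_ (Eq.sym (+-via-·α x u)) (Eq.sym (+-via-·α y v))
    (≈-α _ _ (≈-· _ _ _ _ (≈-α _ _ (≈-· _ _ _ _ x≈y αu≈αv)) αu≈αv))
    where
    αu≈αv : α u ≈ α v
    αu≈αv = ≈-α u v u≈v

  isCongruence : IsCongruence iota _≈_
  isCongruence = record
    { refl = ≈-refl ; sym = ≈-sym ; trans = ≈-trans
    ; +-cong = ≈-+ ; ·-cong = ≈-· ; α-cong = ≈-α }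

  -- x θ 𝟎 unfolds to α x · 𝟎 ∈ I (always true) and α 𝟎 · x = x ∈ I.
  classOfZero : ClassOfZeroIs iota _≈_ I
  classOfZero x = mk⇔
    (λ x≈𝟎 → subst I (α𝟎·x≡x x) (proj₂ x≈𝟎))
    (λ x∈I → subst I (Eq.sym (·-zeroʳ (α x))) zero∈ ,
             subst I (Eq.sym (α𝟎·x≡x x)) x∈I)

theorem2 : ∀ {a ℓ : Level} (A : LukasiewiczNearSemiring a)
           (I : LukasiewiczNearSemiring.Carrier A → Set ℓ) →
           IsIdeal (LukasiewiczNearSemiring.iota A) I →
           IsCongruence (LukasiewiczNearSemiring.iota A) (θ (LukasiewiczNearSemiring.iota A) I)
           × ClassOfZeroIs (LukasiewiczNearSemiring.iota A) (θ (LukasiewiczNearSemiring.iota A) I) I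
theorem2 A I isIdeal =
  IdealCongruence.isCongruence A I isIdeal , IdealCongruence.classOfZero A I isIdeal
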